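{- Let $p\neq q$ be primes, let $\mathbf P$ be a finite abelian $p$-group and $\mathbf Q$ a finite abelian $q$-group, and let $\mathbf G=\mathbf P\times\mathbf Q$. Let $a_1,a_2\in P$ and $b_1,b_2\in Q$. Then $(a_1,b_1)$ and $(a_2,b_2)$ are adjacent in $\mathcal D(\mathbf G)$ if and only if either ($a_1\twoheadrightarrow a_2$ and $b_2\twoheadrightarrow b_1$) or ($a_2\twoheadrightarrow a_1$ and $b_1\twoheadrightarrow b_2$).
   Context: For elements $x,y$ of a group, $x\twoheadrightarrow y$ means that $y$ is a power of $x$ (i.e. $y\in\langle x\rangle$) but $x$ is not a power of $y$. The power graph of a group $\mathbf K$ is the simple graph on $K$ in which two distinct elements are adjacent iff one is a power of the other. The enhanced power graph of $\mathbf K$ is the simple graph on $K$ in which two distinct elements are adjacent iff they generate a cyclic subgroup. The difference graph $\mathcal D(\mathbf K)$ is the graph whose edges are the pairs adjacent in the enhanced power graph but not in the power graph, with all isolated vertices removed (so its vertex set consists of the elements incident to at least one such edge). -}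

module Defs where

open import Level using (Level; _⊔_)
open import Data.Nat using (ℕ; zero; suc; _^_)
open import Data.Integer using (ℤ; +_; -[1+_])
open import Data.Fin using (Fin)
open import Data.Product using (Σ; ∃; _×_; _,_)
open import Data.Sum using (_⊎_)
open import Relation.Nullary using (¬_)
open import Data.Nat.Primality using (Prime)
open import Algebra.Bundles using (Group; AbelianGroup)

module _ {c ℓ : Level} (G : Group c ℓ) where
  open Group G

  HasCardinality : ℕ → Set (c ⊔ ℓ)
  HasCardinality n =
    Σ (Fin n → Carrier) λ f →
      (∀ i j → f i ≈ f j → i ≡ j) × (∀ x → ∃ λ i → f i ≈ x)
    where open import Relation.Binary.PropositionalEquality using (_≡_)

  pow : Carrier → ℕ → Carrier
  pow x zero    = ε
  pow x (suc n) = x ∙ pow x n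

  zpow : Carrier → ℤ → Carrier
  zpow x (+ n)     = pow x n
  zpow x -[1+ n ]  = (pow x (suc n)) ⁻¹

  IsPowerOf : Carrier → Carrier → Set ℓ
  IsPowerOf y x = ∃ λ (k : ℤ) → y ≈ zpow x k

  _↠_ : Carrier → Carrier → Set ℓ
  x ↠ y = IsPowerOf y x × ¬ IsPowerOf x y

  data InGen (x y : Carrier) : Carrier → Set (c ⊔ ℓ) where
    gen₁ : InGen x y x
    gen₂ : InGen x y y
    genε : InGen x y ε
    gen∙ : ∀ {u v} → InGen x y u → InGen x y v → InGen x y (u ∙ v)
    gen⁻¹ : ∀ {u} → InGen x y u → InGen x y (u ⁻¹)
    gen≈ : ∀ {u v} → u ≈ v → InGen x y u → InGen x y v

  -- ⟨x , y⟩ is cyclic: it equals ⟨z⟩ for some z ∈ ⟨x , y⟩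
  GenerateCyclic : Carrier → Carrier → Set (c ⊔ ℓ)
  GenerateCyclic x y =
    ∃ λ z → InGen x y z × IsPowerOf x z × IsPowerOf y z

  PowerAdj : Carrier → Carrier → Set ℓ
  PowerAdj x y = ¬ x ≈ y × (IsPowerOf x y ⊎ IsPowerOf y x)

  EnhancedAdj : Carrier → Carrier → Set (c ⊔ ℓ)
  EnhancedAdj x y = ¬ x ≈ y × GenerateCyclic x y

  -- adjacency in the difference graph 𝒟(G) (removing isolated vertices does
  -- not affect which pairs are adjacent)
  DiffAdj : Carrier → Carrier → Set (c ⊔ ℓ)
  DiffAdj x y = EnhancedAdj x y × ¬ PowerAdj x y

IsPGroup : {c ℓ : Level} → ℕ → AbelianGroup c ℓ → Set (c ⊔ ℓ)
IsPGroup p A = ∃ λ k → HasCardinality (AbelianGroup.group A) (p ^ k)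

{-# OPTIONS --safe #-}
module Submission where

-- By Lagrange (for abelian groups: translating by x permutes the elements, so their product
-- Π satisfies Π = xⁿ Π), P and Q are annihilated by the coprime numbers pᵏ and qˡ. Coprimality
-- yields exponents e₁, e₂ with (a, b)^e₁ = (a, 1) and (a, b)^e₂ = (1, b), so (a₂, b₂) is a power
-- of (a₁, b₁) iff a₂ is a power of a₁ and b₂ of b₁. Since cⁱ and c^gcd(i, pᵏ) are powers of each
-- other and the divisors of pᵏ form a chain, any two powers of one element are comparable. So if
-- (a₁, b₁), (a₂, b₂) lie in a cyclic ⟨(c, d)⟩ and neither is a power of the other, the comparisons
-- of the coordinates must point in strictly opposite directions; conversely, in that situation
-- (a₁, b₂) lies in the subgroup they generate and has both as powers.

open import Defs
open import Level using (Level; _⊔_)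
open import Data.Nat using (ℕ; zero; suc; pred; _+_; _*_; _^_; _≤_; NonZero)
open import Data.Nat.Properties
  using (*-comm; *-assoc; ≤-total; ^-distribˡ-+-*; m^n≢0; m≤n⇒∃[o]m+o≡n; suc-pred)
open import Data.Nat.Divisibility
  using (_∣_; divides; _∣?_; ∣1⇒≡1; ∣-trans; m∣m*n; *-cancelˡ-∣)
open import Data.Nat.GCD using (gcd; gcd[m,n]∣m; gcd[m,n]∣n; gcd-GCD; module Bézout)
open import Data.Nat.Coprimality using (Coprime; coprime-divisor; coprime-Bézout)
import Data.Nat.Coprimality as Coprimality
open import Data.Nat.Primality
  using (Prime; prime⇒irreducible; prime⇒nonZero; euclidsLemma; ¬prime[1])
open import Data.Nat.Tactic.RingSolver using (solve-∀)
open import Data.Integer using (+_; -[1+_])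
open import Data.Fin using (Fin)
open import Data.Fin.Permutation using (Permutation; permutation)
open import Data.Vec.Functional using (replicate)
open import Data.Product using (_×_; _,_; proj₁; proj₂; ∃; ∃₂; uncurry)
open import Data.Sum using (_⊎_; inj₁; inj₂; [_,_])
import Data.Sum as Sum
open import Data.Empty using (⊥-elim)
open import Relation.Nullary using (¬_; yes; no)
open import Relation.Binary.PropositionalEquality as ≡ using (_≡_)
open import Function.Bundles using (_⇔_; mk⇔)
open import Algebra.Bundles using (Group; AbelianGroup)
open import Algebra.Construct.DirectProduct using (group)

∣p^k⇒≡p^i : ∀ {p d} → Prime p → ∀ k → d ∣ p ^ k → ∃ λ i → d ≡ p ^ i
∣p^k⇒≡p^i p-prime zero d∣1 = 0 , ∣1⇒≡1 d∣1
∣p^k⇒≡p^i {p} {d} p-prime (suc k) d∣p^[1+k] with p ∣? d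
... | no p∤d = ∣p^k⇒≡p^i p-prime k (coprime-divisor d⊥p d∣p^[1+k])
  where
  d⊥p : Coprime d p
  d⊥p (i∣d , i∣p) with prime⇒irreducible p-prime i∣p
  ... | inj₁ i≡1    = i≡1
  ... | inj₂ ≡.refl = ⊥-elim (p∤d i∣d)
... | yes (divides d′ ≡.refl)
  with ∣p^k⇒≡p^i p-prime k (*-cancelˡ-∣ p {{prime⇒nonZero p-prime}}
                              (≡.subst (_∣ p ^ suc k) (*-comm d′ p) d∣p^[1+k]))
...   | i , ≡.refl = suc i , *-comm (p ^ i) p

p^i∣p^j : ∀ p {i j} → i ≤ j → p ^ i ∣ p ^ j
p^i∣p^j p {i} i≤j with m≤n⇒∃[o]m+o≡n i≤j
... | o , ≡.refl = ≡.subst (p ^ i ∣_) (≡.sym (^-distribˡ-+-* p i o)) (m∣m*n (p ^ o))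

DivisorsTotallyOrdered : ℕ → Set
DivisorsTotallyOrdered n = ∀ {d e} → d ∣ n → e ∣ n → d ∣ e ⊎ e ∣ d

prime-power-divisors-totally-ordered : ∀ {p} → Prime p → ∀ k → DivisorsTotallyOrdered (p ^ k)
prime-power-divisors-totally-ordered {p} p-prime k d∣p^k e∣p^k
  with ∣p^k⇒≡p^i p-prime k d∣p^k | ∣p^k⇒≡p^i p-prime k e∣p^k
... | i , ≡.refl | j , ≡.refl = Sum.map (p^i∣p^j p) (p^i∣p^j p) (≤-total i j)

prime∣q^l⇒≡ : ∀ {p q} → Prime p → Prime q → ∀ l → p ∣ q ^ l → p ≡ q
prime∣q^l⇒≡ p-prime q-prime zero p∣1 = ⊥-elim (¬prime[1] (≡.subst Prime (∣1⇒≡1 p∣1) p-prime))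
prime∣q^l⇒≡ {p} {q} p-prime q-prime (suc l) p∣q^[1+l]
  with euclidsLemma q (q ^ l) p-prime p∣q^[1+l]
... | inj₂ p∣q^l = prime∣q^l⇒≡ p-prime q-prime l p∣q^l
... | inj₁ p∣q with prime⇒irreducible q-prime p∣q
...   | inj₁ ≡.refl = ⊥-elim (¬prime[1] p-prime)
...   | inj₂ p≡q    = p≡q

distinct-prime-powers-coprime : ∀ {p q} → Prime p → Prime q → ¬ p ≡ q →
                                ∀ k l → Coprime (p ^ k) (q ^ l)
distinct-prime-powers-coprime {p} p-prime q-prime p≢q k l (d∣p^k , d∣q^l)
  with ∣p^k⇒≡p^i p-prime k d∣p^k
... | zero  , d≡1    = d≡1
... | suc i , ≡.refl = ⊥-elim (p≢q (prime∣q^l⇒≡ p-prime q-prime l (∣-trans (m∣m*n (p ^ i)) d∣q^l)))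

coprime⇒1+x*m≡y*n : ∀ {m n} .{{_ : NonZero n}} → Coprime m n → ∃₂ λ x y → 1 + x * m ≡ y * n
coprime⇒1+x*m≡y*n {m} {suc k} m⊥n with coprime-Bézout m⊥n
... | Bézout.-+ x y 1+x*m≡y*n = x , y , 1+x*m≡y*n
-- Multiplying 1 + y n = x m by n - 1 gives the other sign of Bézout's identity.
... | Bézout.+- x y 1+y*n≡x*m = k * x , 1 + k * y , (begin
  1 + k * x * m            ≡⟨ ≡.cong suc (*-assoc k x m) ⟩
  1 + k * (x * m)          ≡⟨ ≡.cong (λ t → 1 + k * t) 1+y*n≡x*m ⟨
  1 + k * (1 + y * suc k)  ≡⟨ expand k y ⟩
  (1 + k * y) * suc k      ∎)
  where
  open ≡.≡-Reasoning
  expand : ∀ k y → 1 + k * (1 + y * suc k) ≡ (1 + k * y) * suc k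
  expand = solve-∀

module Powers {c ℓ : Level} (G : Group c ℓ) where
  open Group G
  open import Algebra.Properties.Monoid.Mult monoid using (×-congʳ; ×-homo-+; ×-assocˡ)
    renaming (_×_ to _×ᴹ_)

  pow≡×ᴹ : ∀ x n → pow G x n ≡ n ×ᴹ x
  pow≡×ᴹ x zero    = ≡.refl
  pow≡×ᴹ x (suc n) = ≡.cong (x ∙_) (pow≡×ᴹ x n)

  pow-cong : ∀ n {x y} → x ≈ y → pow G x n ≈ pow G y n
  pow-cong n {x} {y} x≈y rewrite pow≡×ᴹ x n | pow≡×ᴹ y n = ×-congʳ n x≈y

  pow-+ : ∀ x m n → pow G x (m + n) ≈ pow G x m ∙ pow G x n
  pow-+ x m n rewrite pow≡×ᴹ x (m + n) | pow≡×ᴹ x m | pow≡×ᴹ x n = ×-homo-+ x m n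

  pow-* : ∀ x m n → pow G x (m * n) ≈ pow G (pow G x n) m
  pow-* x m n rewrite pow≡×ᴹ (pow G x n) m | pow≡×ᴹ x n | pow≡×ᴹ x (m * n) = sym (×-assocˡ x m n)

  pow-ε : ∀ n → pow G ε n ≈ ε
  pow-ε zero    = refl
  pow-ε (suc n) = trans (identityˡ _) (pow-ε n)

  IsNatPowerOf : Carrier → Carrier → Set ℓ
  IsNatPowerOf y x = ∃ λ m → y ≈ pow G x m

  IsNatPowerOf⇒IsPowerOf : ∀ {y x} → IsNatPowerOf y x → IsPowerOf G y x
  IsNatPowerOf⇒IsPowerOf (m , y≈xᵐ) = + m , y≈xᵐ

  IsNatPowerOf-trans : ∀ {z y x} → IsNatPowerOf z y → IsNatPowerOf y x → IsNatPowerOf z x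
  IsNatPowerOf-trans {x = x} (m , z≈yᵐ) (n , y≈xⁿ) =
    m * n , trans z≈yᵐ (trans (pow-cong m y≈xⁿ) (sym (pow-* x m n)))

  IsNatPowerOf-respˡ : ∀ {y y′ x} → y ≈ y′ → IsNatPowerOf y x → IsNatPowerOf y′ x
  IsNatPowerOf-respˡ y≈y′ (m , y≈xᵐ) = m , trans (sym y≈y′) y≈xᵐ

  IsNatPowerOf-respʳ : ∀ {y x x′} → x ≈ x′ → IsNatPowerOf y x → IsNatPowerOf y x′
  IsNatPowerOf-respʳ x≈x′ (m , y≈xᵐ) = m , trans y≈xᵐ (pow-cong m x≈x′)

  ∣⇒pow-IsNatPowerOf : ∀ x {d i} → d ∣ i → IsNatPowerOf (pow G x i) (pow G x d)
  ∣⇒pow-IsNatPowerOf x {d} (divides q ≡.refl) = q , pow-* x q d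

  IsPowerOf-reflexive : ∀ {x y} → x ≈ y → IsPowerOf G x y
  IsPowerOf-reflexive {y = y} x≈y = + 1 , trans x≈y (sym (identityʳ y))

  InGen-pow : ∀ {x y u} → InGen G x y u → ∀ n → InGen G x y (pow G u n)
  InGen-pow u∈⟨x,y⟩ zero    = genε
  InGen-pow u∈⟨x,y⟩ (suc n) = gen∙ u∈⟨x,y⟩ (InGen-pow u∈⟨x,y⟩ n)

  InGen-swap : ∀ {x y u} → InGen G x y u → InGen G y x u
  InGen-swap gen₁              = gen₂
  InGen-swap gen₂              = gen₁
  InGen-swap genε              = genε
  InGen-swap (gen∙ u∈ v∈)      = gen∙ (InGen-swap u∈) (InGen-swap v∈)
  InGen-swap (gen⁻¹ u∈)        = gen⁻¹ (InGen-swap u∈)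
  InGen-swap (gen≈ u≈v u∈)     = gen≈ u≈v (InGen-swap u∈)

  DiffAdj-sym : ∀ {x y} → DiffAdj G x y → DiffAdj G y x
  DiffAdj-sym ((x≉y , z , z∈⟨x,y⟩ , x∈⟨z⟩ , y∈⟨z⟩) , ¬x~y) =
    ((λ y≈x → x≉y (sym y≈x)) , z , InGen-swap z∈⟨x,y⟩ , y∈⟨z⟩ , x∈⟨z⟩) ,
    λ (y≉x , y∈⟨x⟩⊎x∈⟨y⟩) → ¬x~y (x≉y , Sum.swap y∈⟨x⟩⊎x∈⟨y⟩)

Annihilates : ∀ {c ℓ} → ℕ → Group c ℓ → Set (c ⊔ ℓ)
Annihilates n G = ∀ x → pow G x n ≈ ε
  where open Group G

module Annihilated {c ℓ : Level} (G : Group c ℓ) (n : ℕ) (annihilates : Annihilates n G) where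
  open Group G
  open Powers G
  open import Algebra.Properties.Group G using (inverseˡ-unique; inverseʳ-unique)
  open import Relation.Binary.Reasoning.Setoid setoid

  pow-*-annihilated : ∀ x m → pow G x (m * n) ≈ ε
  pow-*-annihilated x m = trans (pow-* x m n) (trans (pow-cong m (annihilates x)) (pow-ε m))

  pow-+-*-annihilated : ∀ x a m → pow G x (a + m * n) ≈ pow G x a
  pow-+-*-annihilated x a m = begin
    pow G x (a + m * n)          ≈⟨ pow-+ x a (m * n) ⟩
    pow G x a ∙ pow G x (m * n)  ≈⟨ ∙-congˡ (pow-*-annihilated x m) ⟩
    pow G x a ∙ ε                ≈⟨ identityʳ _ ⟩
    pow G x a                    ∎

  module _ .{{_ : NonZero n}} where

    ⁻¹-IsNatPowerOf : ∀ x → IsNatPowerOf (x ⁻¹) x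
    ⁻¹-IsNatPowerOf x = pred n , sym (inverseʳ-unique x (pow G x (pred n)) x∙xⁿ⁻¹≈ε)
      where
      x∙xⁿ⁻¹≈ε : x ∙ pow G x (pred n) ≈ ε
      x∙xⁿ⁻¹≈ε = ≡.subst (λ k → pow G x k ≈ ε) (≡.sym (suc-pred n)) (annihilates x)

    IsPowerOf⇒IsNatPowerOf : ∀ {y x} → IsPowerOf G y x → IsNatPowerOf y x
    IsPowerOf⇒IsNatPowerOf (+ m       , y≈xᵐ)  = m , y≈xᵐ
    IsPowerOf⇒IsNatPowerOf (-[1+ m ] , y≈x⁻ᵐ) =
      IsNatPowerOf-respˡ (sym y≈x⁻ᵐ) (IsNatPowerOf-trans (⁻¹-IsNatPowerOf _) (suc m , refl))

    pow-gcd-IsNatPowerOf : ∀ x i → IsNatPowerOf (pow G x (gcd i n)) (pow G x i)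
    pow-gcd-IsNatPowerOf x i with Bézout.identity (gcd-GCD i n)
    ... | Bézout.+- a b d+b*n≡a*i = a , (begin
      pow G x (gcd i n)           ≈⟨ pow-+-*-annihilated x (gcd i n) b ⟨
      pow G x (gcd i n + b * n)   ≡⟨ ≡.cong (pow G x) d+b*n≡a*i ⟩
      pow G x (a * i)             ≈⟨ pow-* x a i ⟩
      pow G (pow G x i) a         ∎)
    ... | Bézout.-+ a b d+a*i≡b*n =
      IsNatPowerOf-respˡ (sym xᵈ≈x⁻ᵃⁱ)
        (IsNatPowerOf-trans (⁻¹-IsNatPowerOf _) (a , pow-* x a i))
      where
      xᵈ≈x⁻ᵃⁱ : pow G x (gcd i n) ≈ pow G x (a * i) ⁻¹
      xᵈ≈x⁻ᵃⁱ = inverseˡ-unique _ _ (begin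
        pow G x (gcd i n) ∙ pow G x (a * i)  ≈⟨ pow-+ x (gcd i n) (a * i) ⟨
        pow G x (gcd i n + a * i)            ≡⟨ ≡.cong (pow G x) d+a*i≡b*n ⟩
        pow G x (b * n)                      ≈⟨ pow-*-annihilated x b ⟩
        ε                                    ∎)

    gcd∣gcd⇒pow-IsNatPowerOf : ∀ x i j → gcd i n ∣ gcd j n →
                               IsNatPowerOf (pow G x j) (pow G x i)
    gcd∣gcd⇒pow-IsNatPowerOf x i j gcdᵢ∣gcdⱼ =
      IsNatPowerOf-trans (∣⇒pow-IsNatPowerOf x (gcd[m,n]∣m j n))
        (IsNatPowerOf-trans (∣⇒pow-IsNatPowerOf x gcdᵢ∣gcdⱼ) (pow-gcd-IsNatPowerOf x i))

    powers-comparable : DivisorsTotallyOrdered n → ∀ {x u v} →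
      IsPowerOf G u x → IsPowerOf G v x → IsPowerOf G v u ⊎ IsPowerOf G u v
    powers-comparable total {x} u∈⟨x⟩ v∈⟨x⟩
      with IsPowerOf⇒IsNatPowerOf u∈⟨x⟩ | IsPowerOf⇒IsNatPowerOf v∈⟨x⟩
    ... | i , u≈xⁱ | j , v≈xʲ with total (gcd[m,n]∣n i n) (gcd[m,n]∣n j n)
    ...   | inj₁ gcdᵢ∣gcdⱼ = inj₁ (IsNatPowerOf⇒IsPowerOf
              (IsNatPowerOf-respˡ (sym v≈xʲ) (IsNatPowerOf-respʳ (sym u≈xⁱ)
                (gcd∣gcd⇒pow-IsNatPowerOf x i j gcdᵢ∣gcdⱼ))))
    ...   | inj₂ gcdⱼ∣gcdᵢ = inj₂ (IsNatPowerOf⇒IsPowerOf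
              (IsNatPowerOf-respˡ (sym u≈xⁱ) (IsNatPowerOf-respʳ (sym v≈xʲ)
                (gcd∣gcd⇒pow-IsNatPowerOf x j i gcdⱼ∣gcdᵢ))))

cardinality-annihilates : ∀ {c ℓ} (A : AbelianGroup c ℓ) {n} →
  HasCardinality (AbelianGroup.group A) n → Annihilates n (AbelianGroup.group A)
cardinality-annihilates A {n} (f , f-injective , f-surjective) x =
  identityˡ-unique (pow G x n) (sum f) (sym (begin
    sum f                         ≈⟨ sum-permute f (translation x) ⟩
    sum (λ i → f (shift x i))     ≈⟨ sum-cong-≋ (f-shift x) ⟩
    sum (λ i → x ∙ f i)           ≈⟨ ∑-distrib-+ (λ _ → x) f ⟩
    sum (replicate n x) ∙ sum f   ≈⟨ ∙-congʳ (sum-replicate n) ⟩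
    n ×ᴹ x ∙ sum f                ≡⟨ ≡.cong (_∙ sum f) (≡.sym (pow≡×ᴹ x n)) ⟩
    pow G x n ∙ sum f             ∎))
  where
  G : Group _ _
  G = AbelianGroup.group A

  open AbelianGroup A hiding (group)
  open Powers G using (pow≡×ᴹ)
  open import Algebra.Properties.Group G using (identityˡ-unique)
  open import Algebra.Properties.CommutativeMonoid.Sum commutativeMonoid
    using (sum; sum-permute; sum-cong-≋; ∑-distrib-+; sum-replicate)
  open import Algebra.Properties.Monoid.Mult monoid using () renaming (_×_ to _×ᴹ_)
  open import Relation.Binary.Reasoning.Setoid setoid

  shift : Carrier → Fin n → Fin n
  shift y i = proj₁ (f-surjective (y ∙ f i))

  f-shift : ∀ y i → f (shift y i) ≈ y ∙ f i
  f-shift y i = proj₂ (f-surjective (y ∙ f i))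

  shift-shift : ∀ {y z} → y ∙ z ≈ ε → ∀ i → shift y (shift z i) ≡ i
  shift-shift {y} {z} y∙z≈ε i = f-injective _ _ (begin
    f (shift y (shift z i))  ≈⟨ f-shift y (shift z i) ⟩
    y ∙ f (shift z i)        ≈⟨ ∙-congˡ (f-shift z i) ⟩
    y ∙ (z ∙ f i)            ≈⟨ assoc y z (f i) ⟨
    (y ∙ z) ∙ f i            ≈⟨ ∙-congʳ y∙z≈ε ⟩
    ε ∙ f i                  ≈⟨ identityˡ (f i) ⟩
    f i                      ∎)

  translation : Carrier → Permutation n n
  translation y = permutation (shift y) (shift (y ⁻¹))
    (shift-shift (inverseʳ y)) (shift-shift (inverseˡ y))

crt-exponent : ∀ {c₁ ℓ₁ c₂ ℓ₂} (G₁ : Group c₁ ℓ₁) (G₂ : Group c₂ ℓ₂) {n₁ n₂} .{{_ : NonZero n₂}} →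
  Annihilates n₁ G₁ → Annihilates n₂ G₂ → Coprime n₁ n₂ →
  let module G₁ = Group G₁; module G₂ = Group G₂ in
  ∃ λ e → (∀ a → pow G₁ a e G₁.≈ a) × (∀ b → pow G₂ b e G₂.≈ G₂.ε)
crt-exponent G₁ G₂ {n₁} {n₂} annihilates₁ annihilates₂ n₁⊥n₂
  with coprime⇒1+x*m≡y*n n₁⊥n₂
... | x , y , 1+x*n₁≡y*n₂ =
  y * n₂ , fixes , λ b → Annihilated.pow-*-annihilated G₂ n₂ annihilates₂ b y
  where
  open Group G₁
  open import Relation.Binary.Reasoning.Setoid setoid

  fixes : ∀ a → pow G₁ a (y * n₂) ≈ a
  fixes a = begin
    pow G₁ a (y * n₂)       ≡⟨ ≡.cong (pow G₁ a) 1+x*n₁≡y*n₂ ⟨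
    pow G₁ a (1 + x * n₁)   ≈⟨ Annihilated.pow-+-*-annihilated G₁ n₁ annihilates₁ a 1 x ⟩
    pow G₁ a 1              ≈⟨ identityʳ a ⟩
    a                       ∎

opposite-orientations : ∀ {a b} {A A′ : Set a} {B B′ : Set b} →
  A ⊎ A′ → B ⊎ B′ → ¬ (A × B) → ¬ (A′ × B′) →
  ((A × ¬ A′) × (B′ × ¬ B)) ⊎ ((A′ × ¬ A) × (B × ¬ B′))
opposite-orientations (inj₁ a)  (inj₁ b)  ¬ab _     = ⊥-elim (¬ab (a , b))
opposite-orientations (inj₂ a′) (inj₂ b′) _   ¬a′b′ = ⊥-elim (¬a′b′ (a′ , b′))
opposite-orientations (inj₁ a)  (inj₂ b′) ¬ab ¬a′b′ =
  inj₁ ((a , λ a′ → ¬a′b′ (a′ , b′)) , (b′ , λ b → ¬ab (a , b)))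
opposite-orientations (inj₂ a′) (inj₁ b)  ¬ab ¬a′b′ =
  inj₂ ((a′ , λ a → ¬ab (a , b)) , (b , λ b′ → ¬a′b′ (a′ , b′)))

module DirectProduct {c₁ ℓ₁ c₂ ℓ₂ : Level} (G₁ : Group c₁ ℓ₁) (G₂ : Group c₂ ℓ₂) where
  G : Group (c₁ ⊔ c₂) (ℓ₁ ⊔ ℓ₂)
  G = group G₁ G₂

  private
    module G₁ = Group G₁
    module G₂ = Group G₂
    module G = Group G

  pow-× : ∀ {a b} n → pow G (a , b) n ≡ (pow G₁ a n , pow G₂ b n)
  pow-× zero            = ≡.refl
  pow-× {a} {b} (suc n) = ≡.cong ((a , b) G.∙_) (pow-× n)

  zpow-× : ∀ {a b} k → zpow G (a , b) k ≡ (zpow G₁ a k , zpow G₂ b k)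
  zpow-× (+ n)     = pow-× n
  zpow-× -[1+ n ]  = ≡.cong G._⁻¹ (pow-× (suc n))

  IsPowerOf-unzip : ∀ {a₁ a₂ b₁ b₂} → IsPowerOf G (a₂ , b₂) (a₁ , b₁) →
                    IsPowerOf G₁ a₂ a₁ × IsPowerOf G₂ b₂ b₁
  IsPowerOf-unzip (k , y≈xᵏ) with ≡.subst (_ G.≈_) (zpow-× k) y≈xᵏ
  ... | a₂≈a₁ᵏ , b₂≈b₁ᵏ = (k , a₂≈a₁ᵏ) , (k , b₂≈b₁ᵏ)

  module CoprimeExponents (n₁ n₂ : ℕ) .{{_ : NonZero n₁}} .{{_ : NonZero n₂}}
                 (annihilates₁ : Annihilates n₁ G₁) (annihilates₂ : Annihilates n₂ G₂)
                 (n₁⊥n₂ : Coprime n₁ n₂) where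
    open Group G
    open Powers G
    open import Relation.Binary.Reasoning.Setoid setoid
    private
      module P₁ = Powers G₁
      module P₂ = Powers G₂
      module A₁ = Annihilated G₁ n₁ annihilates₁
      module A₂ = Annihilated G₂ n₂ annihilates₂

    first-projector : ∃ λ e → ∀ a b → pow G (a , b) e ≈ (a , G₂.ε)
    first-projector with crt-exponent G₁ G₂ annihilates₁ annihilates₂ n₁⊥n₂
    ... | e , fixes , kills = e , λ a b → trans (reflexive (pow-× e)) (fixes a , kills b)

    second-projector : ∃ λ e → ∀ a b → pow G (a , b) e ≈ (G₁.ε , b)
    second-projector with crt-exponent G₂ G₁ annihilates₂ annihilates₁ (Coprimality.sym n₁⊥n₂)
    ... | e , fixes , kills = e , λ a b → trans (reflexive (pow-× e)) (kills a , fixes b)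

    private
      e₁ e₂ : ℕ
      e₁ = proj₁ first-projector
      e₂ = proj₁ second-projector

      pow-e₁ : ∀ a b → pow G (a , b) e₁ ≈ (a , G₂.ε)
      pow-e₁ = proj₂ first-projector

      pow-e₂ : ∀ a b → pow G (a , b) e₂ ≈ (G₁.ε , b)
      pow-e₂ = proj₂ second-projector

    IsPowerOf-zip : ∀ {a₁ a₂ b₁ b₂} → IsPowerOf G₁ a₂ a₁ → IsPowerOf G₂ b₂ b₁ →
                    IsPowerOf G (a₂ , b₂) (a₁ , b₁)
    IsPowerOf-zip {a₁} {a₂} {b₁} {b₂} a₂∈⟨a₁⟩ b₂∈⟨b₁⟩
      with A₁.IsPowerOf⇒IsNatPowerOf a₂∈⟨a₁⟩ | A₂.IsPowerOf⇒IsNatPowerOf b₂∈⟨b₁⟩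
    ... | s , a₂≈a₁ˢ | t , b₂≈b₁ᵗ = + (s * e₁ + t * e₂) , sym (begin
      pow G x (s * e₁ + t * e₂)                        ≈⟨ pow-+ x (s * e₁) (t * e₂) ⟩
      pow G x (s * e₁) ∙ pow G x (t * e₂)              ≈⟨ ∙-cong (pow-* x s e₁) (pow-* x t e₂) ⟩
      pow G (pow G x e₁) s ∙ pow G (pow G x e₂) t
        ≈⟨ ∙-cong (pow-cong s (pow-e₁ a₁ b₁)) (pow-cong t (pow-e₂ a₁ b₁)) ⟩
      pow G (a₁ , G₂.ε) s ∙ pow G (G₁.ε , b₁) t        ≡⟨ ≡.cong₂ _∙_ (pow-× s) (pow-× t) ⟩
      (pow G₁ a₁ s , pow G₂ G₂.ε s) ∙ (pow G₁ G₁.ε t , pow G₂ b₁ t)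
        ≈⟨ G₁.∙-congˡ (P₁.pow-ε t) , G₂.∙-congʳ (P₂.pow-ε s) ⟩
      (pow G₁ a₁ s G₁.∙ G₁.ε , G₂.ε G₂.∙ pow G₂ b₁ t)  ≈⟨ G₁.identityʳ _ , G₂.identityˡ _ ⟩
      (pow G₁ a₁ s , pow G₂ b₁ t)                      ≈⟨ G₁.sym a₂≈a₁ˢ , G₂.sym b₂≈b₁ᵗ ⟩
      (a₂ , b₂)                                        ∎)
      where x = (a₁ , b₁)

    ↠-opposite⇒DiffAdj : ∀ {a₁ a₂ b₁ b₂} → _↠_ G₁ a₁ a₂ → _↠_ G₂ b₂ b₁ →
                         DiffAdj G (a₁ , b₁) (a₂ , b₂)
    ↠-opposite⇒DiffAdj {a₁} {a₂} {b₁} {b₂} (a₂∈⟨a₁⟩ , a₁∉⟨a₂⟩) (b₁∈⟨b₂⟩ , b₂∉⟨b₁⟩) =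
      (x≉y , (a₁ , b₂) , z∈⟨x,y⟩ ,
        IsPowerOf-zip (P₁.IsPowerOf-reflexive G₁.refl) b₁∈⟨b₂⟩ ,
        IsPowerOf-zip a₂∈⟨a₁⟩ (P₂.IsPowerOf-reflexive G₂.refl)) ,
      ¬x~y
      where
      x≉y : ¬ (a₁ , b₁) ≈ (a₂ , b₂)
      x≉y (a₁≈a₂ , _) = a₁∉⟨a₂⟩ (P₁.IsPowerOf-reflexive a₁≈a₂)

      z∈⟨x,y⟩ : InGen G (a₁ , b₁) (a₂ , b₂) (a₁ , b₂)
      z∈⟨x,y⟩ = gen≈ xᵉ¹∙yᵉ²≈z (gen∙ (InGen-pow gen₁ e₁) (InGen-pow gen₂ e₂))
        where
        xᵉ¹∙yᵉ²≈z : pow G (a₁ , b₁) e₁ ∙ pow G (a₂ , b₂) e₂ ≈ (a₁ , b₂)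
        xᵉ¹∙yᵉ²≈z = trans (∙-cong (pow-e₁ a₁ b₁) (pow-e₂ a₂ b₂)) (G₁.identityʳ a₁ , G₂.identityˡ b₂)

      ¬x~y : ¬ PowerAdj G (a₁ , b₁) (a₂ , b₂)
      ¬x~y (_ , inj₁ x∈⟨y⟩) = a₁∉⟨a₂⟩ (proj₁ (IsPowerOf-unzip x∈⟨y⟩))
      ¬x~y (_ , inj₂ y∈⟨x⟩) = b₂∉⟨b₁⟩ (proj₂ (IsPowerOf-unzip y∈⟨x⟩))

    module _ (total₁ : DivisorsTotallyOrdered n₁) (total₂ : DivisorsTotallyOrdered n₂) where

      DiffAdj⇒↠-opposite : ∀ {a₁ a₂ b₁ b₂} → DiffAdj G (a₁ , b₁) (a₂ , b₂) →
        (_↠_ G₁ a₁ a₂ × _↠_ G₂ b₂ b₁) ⊎ (_↠_ G₁ a₂ a₁ × _↠_ G₂ b₁ b₂)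
      DiffAdj⇒↠-opposite ((x≉y , (c , d) , _ , x∈⟨z⟩ , y∈⟨z⟩) , ¬x~y)
        with IsPowerOf-unzip x∈⟨z⟩ | IsPowerOf-unzip y∈⟨z⟩
      ... | a₁∈⟨c⟩ , b₁∈⟨d⟩ | a₂∈⟨c⟩ , b₂∈⟨d⟩ = opposite-orientations
        (A₁.powers-comparable total₁ a₁∈⟨c⟩ a₂∈⟨c⟩)
        (A₂.powers-comparable total₂ b₁∈⟨d⟩ b₂∈⟨d⟩)
        (λ (a₂∈⟨a₁⟩ , b₂∈⟨b₁⟩) → ¬x~y (x≉y , inj₂ (IsPowerOf-zip a₂∈⟨a₁⟩ b₂∈⟨b₁⟩)))
        (λ (a₁∈⟨a₂⟩ , b₁∈⟨b₂⟩) → ¬x~y (x≉y , inj₁ (IsPowerOf-zip a₁∈⟨a₂⟩ b₁∈⟨b₂⟩)))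

      DiffAdj⇔↠-opposite : ∀ a₁ a₂ b₁ b₂ → DiffAdj G (a₁ , b₁) (a₂ , b₂) ⇔
        ((_↠_ G₁ a₁ a₂ × _↠_ G₂ b₂ b₁) ⊎ (_↠_ G₁ a₂ a₁ × _↠_ G₂ b₁ b₂))
      DiffAdj⇔↠-opposite _ _ _ _ = mk⇔ DiffAdj⇒↠-opposite [ uncurry ↠-opposite⇒DiffAdj ,
        (λ (a₂↠a₁ , b₁↠b₂) → DiffAdj-sym (↠-opposite⇒DiffAdj a₂↠a₁ b₁↠b₂)) ]

lemma3p2 : {c₁ ℓ₁ c₂ ℓ₂ : Level} (p q : ℕ) → Prime p → Prime q → ¬ p ≡ q →
    (P : AbelianGroup c₁ ℓ₁) → (Q : AbelianGroup c₂ ℓ₂) →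
    IsPGroup p P → IsPGroup q Q →
    (a₁ a₂ : AbelianGroup.Carrier P) (b₁ b₂ : AbelianGroup.Carrier Q) →
    DiffAdj (group (AbelianGroup.group P) (AbelianGroup.group Q)) (a₁ , b₁) (a₂ , b₂)
      ⇔ ((_↠_ (AbelianGroup.group P) a₁ a₂ × _↠_ (AbelianGroup.group Q) b₂ b₁)
         ⊎ (_↠_ (AbelianGroup.group P) a₂ a₁ × _↠_ (AbelianGroup.group Q) b₁ b₂))
lemma3p2 p q p-prime q-prime p≢q P Q (k , |P|≡p^k) (l , |Q|≡q^l) =
  DiffAdj⇔↠-opposite (prime-power-divisors-totally-ordered p-prime k)
                     (prime-power-divisors-totally-ordered q-prime l)
  where
  instance
    p^k≢0 : NonZero (p ^ k)
    p^k≢0 = m^n≢0 p k {{prime⇒nonZero p-prime}}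
    q^l≢0 : NonZero (q ^ l)
    q^l≢0 = m^n≢0 q l {{prime⇒nonZero q-prime}}

  open DirectProduct (AbelianGroup.group P) (AbelianGroup.group Q)
  open CoprimeExponents (p ^ k) (q ^ l)
    (cardinality-annihilates P |P|≡p^k) (cardinality-annihilates Q |Q|≡q^l)
    (distinct-prime-powers-coprime p-prime q-prime p≢q k l)
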